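{- Let $\mathcal X=(\Omega,S)$ be a quasiregular coherent configuration of type $\{G_i\}_{i\in I}$ with all $G_i$ abelian, with data $G_{ij}$, $f_{ij}$ as in the context. Let $G=\prod_{i\in I}G_i$ act on $\Omega$ so that $s\in G_i$ maps each $\alpha\in\Omega_i$ to the unique element of $\alpha s$ and fixes every point outside $\Omega_i$. Then $\mathcal X$ is schurian if and only if there exists a subgroup $H\le G$ such that for all $i,j\in I$ the restriction of $H$ to $\Omega_i\cup\Omega_j$, viewed as a subgroup of $G_i\times G_j$, equals $\{(s_i,s_j)\in G_i\times G_j: f_{ij}(G_{ij}s_i)=G_{ji}s_j\}$.
   Context: A coherent configuration is a pair $(\Omega,S)$ where $\Omega$ is a finite set and $S$ is a partition of $\Omega\times\Omega$ (basis relations) such that $1_\Omega$ is a union of basis relations, $s^*=\{(\beta,\alpha):(\alpha,\beta)\in s\}\in S$ for all $s\in S$, and for all $r,s,t\in S$ the number $|\alpha r\cap\beta s^*|$ is independent of $(\alpha,\beta)\in t$, where $\alpha r=\{\beta:(\alpha,\beta)\in r\}$. A fiber is a set $\Delta$ with $1_\Delta\in S$. A relation $s$ is thin if $|\alpha s|\le1$ and $|\alpha s^*|\le1$ for all $\alpha$. Quasiregular: for each fiber all basis relations in its square are thin. Type $\{G_i\}_{i\in I}$: the fibers are $\Omega_i$ and $G_i$ is the group (under composition of relations) of basis relations contained in $\Omega_i\times\Omega_i$. The complex product $rs$ of basis relations is the set of basis relations contained in $\{(\alpha,\beta):(\alpha,\gamma)\in r,(\gamma,\beta)\in s\text{ for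 some }\gamma\}$, extended to sets by $XY=\bigcup rs$. Choose $\alpha_i\in\Omega_i$, let $s_{ij}$ be the basis relation containing $(\alpha_i,\alpha_j)$, $G_{ij}=s_{ij}s_{ij}^*\le G_i$, and $f_{ij}:G_i/G_{ij}\to G_j/G_{ji}$, $G_{ij}s\mapsto s_{ij}^*(G_{ij}s)s_{ij}$. Schurian: $S$ is the set of orbits on $\Omega\times\Omega$ of some permutation group on $\Omega$. -}

module Defs where

open import Level using (0ℓ)
open import Data.Nat using (ℕ)
open import Data.Fin using (Fin; _≟_)
open import Data.Fin.Permutation using (Permutation′; _⟨$⟩ʳ_; _⟨$⟩ˡ_)
open import Data.List using (List; length; filter; allFin)
open import Data.Product using (Σ; ∃; ∃-syntax; _×_; _,_)
open import Relation.Nullary using (¬_)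
open import Relation.Nullary.Decidable using (_×-dec_)
open import Relation.Unary using (Pred; _∈_; _≐_; ｛_｝)
open import Relation.Binary.PropositionalEquality using (_≡_)
open import Function.Bundles using (_⇔_)

-- A partition S of Ω × Ω, Ω = Fin n, into m basis relations is encoded by a
-- colouring c : Ω → Ω → Fin m; the basis relation with colour r is
-- { (α , β) | c α β ≡ r }.  Surjectivity of c makes every part nonempty.
Colouring : ℕ → ℕ → Set
Colouring n m = Fin n → Fin n → Fin m

module _ {n m : ℕ} (c : Colouring n m) where

  intersectionCount : Fin m → Fin m → Fin n → Fin n → ℕ
  intersectionCount r s α β =
    length (filter (λ γ → (c α γ ≟ r) ×-dec (c γ β ≟ s)) (allFin n))

  record IsCoherentConfiguration : Set where
    field
      surjective : ∀ (r : Fin m) → ∃[ α ] ∃[ β ] c α β ≡ r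
      -- 1_Ω is a union of basis relations
      diagonal   : ∀ α β γ → c α α ≡ c β γ → β ≡ γ
      transpose  : ∀ (s : Fin m) → ∃[ u ] (∀ α β → (c α β ≡ s) ⇔ (c β α ≡ u))
      intersection : ∀ (r s : Fin m) α β γ δ → c α β ≡ c γ δ →
                     intersectionCount r s α β ≡ intersectionCount r s γ δ

  -- Fibers are indexed by the colours d of basis relations of the form 1_Δ;
  -- the fiber is Δ = { α | c α α ≡ d }.
  IsFiber : Fin m → Set
  IsFiber d = ∃[ α ] c α α ≡ d

  InGroup : Fin m → Fin m → Set
  InGroup d r = ∀ α β → c α β ≡ r → (c α α ≡ d) × (c β β ≡ d)

  IsThin : Fin m → Set
  IsThin r = (∀ α β γ → c α β ≡ r → c α γ ≡ r → β ≡ γ)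
           × (∀ α β γ → c β α ≡ r → c γ α ≡ r → β ≡ γ)

  IsQuasiregular : Set
  IsQuasiregular = ∀ d → IsFiber d → ∀ r → InGroup d r → IsThin r

  _* : Pred (Fin m) 0ℓ → Pred (Fin m) 0ℓ
  (X *) u = ∃[ α ] ∃[ β ] (c α β ∈ X) × (c β α ≡ u)

  _·_ : Pred (Fin m) 0ℓ → Pred (Fin m) 0ℓ → Pred (Fin m) 0ℓ
  (X · Y) t = ∃[ α ] ∃[ β ] ∃[ γ ] (c α β ∈ X) × (c β γ ∈ Y) × (c α γ ≡ t)

  AllGroupsAbelian : Set
  AllGroupsAbelian = ∀ d → IsFiber d → ∀ r s → InGroup d r → InGroup d s →
                     (｛ r ｝ · ｛ s ｝) ≐ (｛ s ｝ · ｛ r ｝)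

  IsPermGroup : Pred (Permutation′ n) 0ℓ → Set
  IsPermGroup K =
      (∃[ ι ] (ι ∈ K) × (∀ x → ι ⟨$⟩ʳ x ≡ x))
    × (∀ π σ → π ∈ K → σ ∈ K → ∃[ τ ] (τ ∈ K) × (∀ x → τ ⟨$⟩ʳ x ≡ σ ⟨$⟩ʳ (π ⟨$⟩ʳ x)))
    × (∀ π → π ∈ K → ∃[ τ ] (τ ∈ K) × (∀ x → τ ⟨$⟩ʳ x ≡ π ⟨$⟩ˡ x))

  IsSchurian : Set₁
  IsSchurian = ∃[ K ] IsPermGroup K ×
    (∀ α β γ δ → (c α β ≡ c γ δ) ⇔ (∃[ g ] (g ∈ K) × (g ⟨$⟩ʳ α ≡ γ) × (g ⟨$⟩ʳ β ≡ δ)))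

  IsBasePointChoice : (Fin m → Fin n) → Set
  IsBasePointChoice pt = ∀ d → IsFiber d → c (pt d) (pt d) ≡ d

  module _ (pt : Fin m → Fin n) where
    sRel : Fin m → Fin m → Fin m
    sRel i j = c (pt i) (pt j)

    Gsub : Fin m → Fin m → Pred (Fin m) 0ℓ
    Gsub i j = ｛ sRel i j ｝ · (｛ sRel i j ｝ *)

    coset : Fin m → Fin m → Fin m → Pred (Fin m) 0ℓ
    coset i j s = Gsub i j · ｛ s ｝

    fMap : Fin m → Fin m → Pred (Fin m) 0ℓ → Pred (Fin m) 0ℓ
    fMap i j C = ((｛ sRel i j ｝ *) · C) · ｛ sRel i j ｝

    InGraph : Fin m → Fin m → Fin m → Fin m → Set
    InGraph i j si sj = InGroup i si × InGroup j sj ×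
                        (fMap i j (coset i j si) ≐ coset j i sj)

  -- Elements of G = ∏_{i ∈ I} G_i: functions e assigning to every fiber d an
  -- element e d ∈ G_d (values at non-fiber colours are irrelevant).
  InG : (Fin m → Fin m) → Set
  InG e = ∀ d → IsFiber d → InGroup d (e d)

  IsSubgroupOfG : Pred (Fin m → Fin m) 0ℓ → Set
  IsSubgroupOfG H =
      (∀ e → e ∈ H → InG e)
    × (∃[ e ] (e ∈ H) × (∀ d → IsFiber d → e d ≡ d))
    × (∀ e e′ → e ∈ H → e′ ∈ H →
         ∃[ e″ ] (e″ ∈ H) × (∀ d → IsFiber d → e″ d ∈ (｛ e d ｝ · ｛ e′ d ｝)))
    × (∀ e → e ∈ H →
         ∃[ e′ ] (e′ ∈ H) × (∀ d → IsFiber d → e′ d ∈ (｛ e d ｝ *)))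

  Restriction : Pred (Fin m → Fin m) 0ℓ → Fin m → Fin m → Fin m → Fin m → Set
  Restriction H i j si sj = ∃[ e ] (e ∈ H) × (e i ≡ si) × (e j ≡ sj)

-- Every basis relation inside a fibre is thin, i.e. the graph of a bijection,
-- so each e ∈ G moves every point α along the relation e (fib α); a
-- permutation doing exactly this "realises" e.
module Submission where

open import Defs
open import Level using (0ℓ)
open import Data.Nat using (ℕ)
open import Data.Fin using (Fin; _≟_)
open import Data.Fin.Permutation
  using (Permutation′; _⟨$⟩ʳ_; _⟨$⟩ˡ_; permutation; inverseʳ)
open import Data.List using (List; []; _∷_; length; filter; allFin)
open import Data.List.Membership.Propositional renaming (_∈_ to _∈L_)
open import Data.List.Membership.Propositional.Properties
  using (∈-filter⁺; ∈-filter⁻; ∈-allFin)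
open import Data.List.Relation.Unary.Any using (here)
open import Data.Product using (∃-syntax; _×_; _,_; proj₁; proj₂)
open import Relation.Nullary.Decidable using (_×-dec_)
open import Relation.Binary.PropositionalEquality
open import Function.Bundles using (_⇔_; Equivalence; mk⇔)
open import Relation.Unary using (Pred; _∈_; ｛_｝)

-- A list of the same length as a nonempty list is nonempty; this turns an
-- equality of intersection numbers into the existence of a path.
nonempty-of-same-length : ∀ {A : Set} {x : A} (xs ys : List A) →
  length xs ≡ length ys → x ∈L xs → ∃[ y ] y ∈L ys
nonempty-of-same-length (_ ∷ _) (y ∷ _) _  _ = y , here refl
nonempty-of-same-length (_ ∷ _) []      () _

module Paths {n m : ℕ} (c : Colouring n m) (cc : IsCoherentConfiguration c) where
  open IsCoherentConfiguration cc

  fib : Fin n → Fin m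
  fib α = c α α

  -- A path α -r→ x -s→ β can be copied to any (γ , δ) coloured like (α , β),
  -- because the number of such paths is an intersection number.
  path-transfer : ∀ {α β γ δ x r s} → c α β ≡ c γ δ → c α x ≡ r → c x β ≡ s →
                  ∃[ y ] c γ y ≡ r × c y δ ≡ s
  path-transfer {α} {β} {γ} {δ} {x} {r} {s} eq p q =
    let onPath₁ = λ z → (c α z ≟ r) ×-dec (c z β ≟ s)
        onPath₂ = λ z → (c γ z ≟ r) ×-dec (c z δ ≟ s)
        x∈paths = ∈-filter⁺ onPath₁ (∈-allFin x) (p , q)
        (y , y∈paths) = nonempty-of-same-length
          (filter onPath₁ (allFin n)) (filter onPath₂ (allFin n))
          (intersection r s α β γ δ eq) x∈paths
    in y , proj₂ (∈-filter⁻ onPath₂ {xs = allFin n} y∈paths)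

  -- Transposition respects colours, since s* is again a basis relation.
  colour-transpose : ∀ {α β γ δ} → c α β ≡ c γ δ → c β α ≡ c δ γ
  colour-transpose {α} {β} {γ} {δ} eq =
    let (_ , isTranspose) = transpose (c α β)
    in trans (Equivalence.to (isTranspose α β) refl)
             (sym (Equivalence.to (isTranspose γ δ) (sym eq)))

  fibre-source : ∀ {α β γ δ} → c α β ≡ c γ δ → fib α ≡ fib γ
  fibre-source {α} {β} {γ} {δ} eq =
    let (y , γy , _) = path-transfer {x = α} eq refl refl
    in subst (λ z → c α α ≡ c γ z) (sym (diagonal α γ y (sym γy))) (sym γy)

  fibre-target : ∀ {α β γ δ} → c α β ≡ c γ δ → fib β ≡ fib δ
  fibre-target eq = fibre-source (colour-transpose eq)

  -- Moving the ends of pairs: the colour of (a , b) is carried over to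
  -- (a′ , b′) when a, b are reached from y, x as a′, b′ are from y′, x′,
  -- provided a′ and b′ are the only points so reached (thinness).
  pair-colour-transfer : ∀ {y x y′ x′ a b a′ b′} → c y x ≡ c y′ x′ →
    c y a ≡ c y′ a′ → c x b ≡ c x′ b′ →
    (∀ {z} → c y′ z ≡ c y′ a′ → z ≡ a′) → (∀ {z} → c z x′ ≡ c b′ x′ → z ≡ b′) →
    c a b ≡ c a′ b′
  pair-colour-transfer {y} {x} {y′} {x′} {a} {b} {a′} {b′}
                       yx ya xb a′-unique b′-unique =
    let (z , y′z , zx′) = path-transfer {x = a} yx refl refl
        ax′ : c a x ≡ c a′ x′
        ax′ = subst (λ w → c a x ≡ c w x′) (a′-unique (trans y′z ya)) (sym zx′)
        (w , a′w , wx′) = path-transfer {x = b} ax′ refl refl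
        w≡b′ = b′-unique (trans wx′ (colour-transpose xb))
    in sym (subst (λ v → c a′ v ≡ c a b) w≡b′ a′w)

  Preserves : Fin m → Fin m → Fin m → Fin m → Set
  Preserves i j sᵢ sⱼ = ∀ a b a′ b′ → fib a ≡ i → fib b ≡ j →
    c a a′ ≡ sᵢ → c b b′ ≡ sⱼ → c a′ b′ ≡ c a b

module Steps {n m : ℕ} (c : Colouring n m) (cc : IsCoherentConfiguration c)
             (qr : IsQuasiregular c) where
  open IsCoherentConfiguration cc
  open Paths c cc

  step-in-group : ∀ {α β} → fib α ≡ fib β → InGroup c (fib α) (c α β)
  step-in-group e x y p = fibre-source p , trans (fibre-target p) (sym e)

  target-unique : ∀ {α β γ} → fib α ≡ fib β → c α β ≡ c α γ → β ≡ γ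
  target-unique {α} {β} {γ} e p =
    proj₁ (qr (fib α) (α , refl) (c α β) (step-in-group e)) α β γ refl (sym p)

  source-unique : ∀ {α β γ} → fib α ≡ fib β → c α β ≡ c γ β → α ≡ γ
  source-unique {α} {β} {γ} e p =
    proj₂ (qr (fib α) (α , refl) (c α β) (step-in-group e)) β α γ refl (sym p)

  step : ∀ {d r} → InGroup c d r → ∀ α → fib α ≡ d → ∃[ β ] c α β ≡ r
  step {r = r} r∈G α e =
    let (α₀ , β₀ , p) = surjective r
        (y , αy , _) = path-transfer {x = β₀} (trans (proj₁ (r∈G α₀ β₀ p)) (sym e)) p refl
    in y , αy

  step-back : ∀ {d r} → InGroup c d r → ∀ α → fib α ≡ d → ∃[ β ] c β α ≡ r
  step-back {r = r} r∈G α e =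
    let (α₀ , β₀ , p) = surjective r
        (y , _ , yα) = path-transfer {x = α₀} (trans (proj₂ (r∈G α₀ β₀ p)) (sym e)) refl p
    in y , yα

  record Realises (g : Permutation′ n) (e : Fin m → Fin m) : Set where
    constructor realises
    field moves : ∀ α → c α (g ⟨$⟩ʳ α) ≡ e (fib α)
  open Realises public

  realiser-fibre : ∀ {g e} → InG c e → Realises g e → ∀ α → fib (g ⟨$⟩ʳ α) ≡ fib α
  realiser-fibre e∈G gₑ α = proj₂ (e∈G (fib α) (α , refl) α _ (moves gₑ α))

  realiser-unique : ∀ {g e α β} → InG c e → Realises g e →
                    c α β ≡ e (fib α) → g ⟨$⟩ʳ α ≡ β
  realiser-unique {α = α} e∈G gₑ p =
    target-unique (sym (realiser-fibre e∈G gₑ α)) (trans (moves gₑ α) (sym p))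

  module _ (e : Fin m → Fin m) (e∈G : InG c e) where
    private
      e-at : ∀ α → InGroup c (fib α) (e (fib α))
      e-at α = e∈G (fib α) (α , refl)

      forward backward : Fin n → Fin n
      forward α  = proj₁ (step (e-at α) α refl)
      backward α = proj₁ (step-back (e-at α) α refl)

      forward-colour : ∀ α → c α (forward α) ≡ e (fib α)
      forward-colour α = proj₂ (step (e-at α) α refl)

      backward-colour : ∀ α → c (backward α) α ≡ e (fib α)
      backward-colour α = proj₂ (step-back (e-at α) α refl)

      forward-backward : ∀ β → forward (backward β) ≡ β
      forward-backward β =
        let b = backward β
            fibre-b = proj₁ (e-at β b β (backward-colour β))
        in target-unique (sym (proj₂ (e-at b b (forward b) (forward-colour b))))
             (trans (forward-colour b) (trans (cong e fibre-b) (sym (backward-colour β))))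

      backward-forward : ∀ α → backward (forward α) ≡ α
      backward-forward α =
        let f = forward α
            fibre-f = proj₂ (e-at α α f (forward-colour α))
        in sym (source-unique (sym fibre-f)
                 (trans (forward-colour α) (trans (cong e (sym fibre-f)) (sym (backward-colour f)))))

    actionOf : Permutation′ n
    actionOf = permutation forward backward forward-backward backward-forward

    actionOf-realises : Realises actionOf e
    actionOf-realises = realises forward-colour

  realise-identity : ∀ {g e} → InG c e → Realises g e →
                     (∀ d → IsFiber c d → e d ≡ d) → ∀ x → g ⟨$⟩ʳ x ≡ x
  realise-identity e∈G gₑ e≡id x = realiser-unique e∈G gₑ (sym (e≡id (fib x) (x , refl)))

  IsProduct : (e e′ e″ : Fin m → Fin m) → Set
  IsProduct e e′ e″ = ∀ d → IsFiber c d → e″ d ∈ _·_ c ｛ e d ｝ ｛ e′ d ｝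

  IsInverse : (e e′ : Fin m → Fin m) → Set
  IsInverse e e′ = ∀ d → IsFiber c d → e′ d ∈ _* c ｛ e d ｝

  realise-product : ∀ {g g′ τ e e′ e″} → InG c e → InG c e′ →
    Realises g e → Realises g′ e′ → Realises τ e″ →
    IsProduct e e′ e″ ⇔ (∀ x → τ ⟨$⟩ʳ x ≡ g′ ⟨$⟩ʳ (g ⟨$⟩ʳ x))
  realise-product {g} {g′} {τ} {e} {e′} {e″} e∈G e′∈G gₑ g′ₑ τₑ = mk⇔ to from
    where
    to : IsProduct e e′ e″ → ∀ x → τ ⟨$⟩ʳ x ≡ g′ ⟨$⟩ʳ (g ⟨$⟩ʳ x)
    to product x =
      let (a , b , _ , ab , bc , ac) = product (fib x) (x , refl)
          (y , xy , yτx) = path-transfer {x = b} (trans ac (sym (moves τₑ x))) refl refl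
          gx≡y = realiser-unique e∈G gₑ (trans xy (sym ab))
      in sym (realiser-unique e′∈G g′ₑ
           (begin
             c (g ⟨$⟩ʳ x) (τ ⟨$⟩ʳ x) ≡⟨ cong (λ z → c z (τ ⟨$⟩ʳ x)) gx≡y ⟩
             c y (τ ⟨$⟩ʳ x)          ≡⟨ trans yτx (sym bc) ⟩
             e′ (fib x)              ≡⟨ cong e′ (sym (realiser-fibre e∈G gₑ x)) ⟩
             e′ (fib (g ⟨$⟩ʳ x))     ∎))
      where open ≡-Reasoning

    from : (∀ x → τ ⟨$⟩ʳ x ≡ g′ ⟨$⟩ʳ (g ⟨$⟩ʳ x)) → IsProduct e e′ e″
    from composite _ (α , refl) =
      α , g ⟨$⟩ʳ α , τ ⟨$⟩ʳ α , sym (moves gₑ α) ,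
      trans (cong e′ (sym (realiser-fibre e∈G gₑ α)))
            (trans (sym (moves g′ₑ (g ⟨$⟩ʳ α))) (cong (c (g ⟨$⟩ʳ α)) (sym (composite α)))) ,
      moves τₑ α

  realise-inverse : ∀ {g g′ e e′} → InG c e → InG c e′ →
    Realises g e → Realises g′ e′ → IsInverse e e′ ⇔ (∀ x → g′ ⟨$⟩ʳ x ≡ g ⟨$⟩ˡ x)
  realise-inverse {g} {g′} {e} {e′} e∈G e′∈G gₑ g′ₑ = mk⇔ to from
    where
    to : IsInverse e e′ → ∀ x → g′ ⟨$⟩ʳ x ≡ g ⟨$⟩ˡ x
    to inverse x =
      let y = g ⟨$⟩ˡ x
          g-y = inverseʳ g {x}
          fibre-y : fib x ≡ fib y
          fibre-y = subst (λ u → fib u ≡ fib y) g-y (realiser-fibre e∈G gₑ y)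
          (a , b , ab , ba) = inverse (fib x) (x , refl)
          yx : c y x ≡ c a b
          yx = trans (subst (λ u → c y u ≡ e (fib y)) g-y (moves gₑ y))
                     (trans (cong e (sym fibre-y)) ab)
      in realiser-unique e′∈G g′ₑ (trans (colour-transpose yx) ba)

    from : (∀ x → g′ ⟨$⟩ʳ x ≡ g ⟨$⟩ˡ x) → IsInverse e e′
    from inverse _ (α , refl) =
      g′ ⟨$⟩ʳ α , α ,
      trans (cong e (sym (realiser-fibre e′∈G g′ₑ α)))
            (trans (sym (moves gₑ (g′ ⟨$⟩ʳ α)))
                   (cong (c (g′ ⟨$⟩ʳ α)) (trans (cong (g ⟨$⟩ʳ_) (inverse α)) (inverseʳ g)))) ,
      moves g′ₑ α

  IsAutomorphism : Permutation′ n → Set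
  IsAutomorphism g = ∀ α β → c α β ≡ c (g ⟨$⟩ʳ α) (g ⟨$⟩ʳ β)

  automorphism-realises-InG : ∀ {g e} → IsAutomorphism g → Realises g e → InG c e
  automorphism-realises-InG {g} aut gₑ _ (α , refl) =
    subst (InGroup c (fib α)) (moves gₑ α) (step-in-group {α} {g ⟨$⟩ʳ α} (aut α α))

  automorphism-preserves : ∀ {g e} → IsAutomorphism g → InG c e → Realises g e →
                           ∀ i j → Preserves i j (e i) (e j)
  automorphism-preserves {e = e} aut e∈G gₑ i j a b a′ b′ fa fb aa′ bb′ =
    let ga≡a′ = realiser-unique e∈G gₑ (trans aa′ (cong e (sym fa)))
        gb≡b′ = realiser-unique e∈G gₑ (trans bb′ (cong e (sym fb)))
    in sym (subst₂ (λ u v → c a b ≡ c u v) ga≡a′ gb≡b′ (aut a b))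

module Abelian {n m : ℕ} (c : Colouring n m) (cc : IsCoherentConfiguration c)
               (qr : IsQuasiregular c) (ab : AllGroupsAbelian c) where
  open Paths c cc
  open Steps c cc qr

  -- rs = sr in G_(fib α): the squares α -r→ β -s→ γ, α -s→ β′ -r→ γ close.
  steps-commute : ∀ {α β γ β′ r s} → fib α ≡ fib β → fib α ≡ fib γ → fib α ≡ fib β′ →
                  c α β ≡ r → c β γ ≡ s → c α β′ ≡ s → c β′ γ ≡ r
  steps-commute {α} {β} {γ} {β′} {r} {s} eβ eγ eβ′ αβ βγ αβ′ =
    let r∈G = subst (InGroup c (fib α)) αβ (step-in-group eβ)
        s∈G = subst (InGroup c (fib α)) βγ
                (subst (λ z → InGroup c z (c β γ)) (sym eβ) (step-in-group (trans (sym eβ) eγ)))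
        (_ , b , _ , p₁ , p₂ , p₃) = proj₁ (ab (fib α) (α , refl) r s r∈G s∈G)
                                          (α , β , γ , sym αβ , sym βγ , refl)
        (y , αy , yγ) = path-transfer {x = b} p₃ refl refl
        β′≡y = target-unique eβ′ (trans αβ′ (trans p₁ (sym αy)))
    in subst (λ z → c z γ ≡ r) (sym β′≡y) (trans yγ (sym p₂))

  translate : ∀ {i sᵢ p p′ a} → InGroup c i sᵢ → fib p ≡ i → c p p′ ≡ sᵢ → fib a ≡ i →
              ∃[ a″ ] c p′ a″ ≡ c p a × c a a″ ≡ sᵢ
  translate {p = p} {p′} {a} sᵢ∈G fp pp′ fa =
    let fp′ = proj₂ (sᵢ∈G p p′ pp′)
        (a″ , p′a″) = step (step-in-group {p} {a} (trans fp (sym fa))) p′ (trans fp′ (sym fp))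
        fa″ = trans (fibre-target p′a″) (trans fa (sym fp′))
    in a″ , p′a″ ,
       steps-commute {p} {p′} {a″} {a} (trans fp (sym fp′)) (trans (trans fp (sym fp′)) (sym fa″))
                     (trans fp (sym fa)) pp′ p′a″ refl

  preserves-from-pair : ∀ {i j sᵢ sⱼ p q p′ q′} → InGroup c i sᵢ → InGroup c j sⱼ →
    fib p ≡ i → fib q ≡ j → c p p′ ≡ sᵢ → c q q′ ≡ sⱼ → c p′ q′ ≡ c p q →
    Preserves i j sᵢ sⱼ
  preserves-from-pair {p = p} {q} {p′} {q′} sᵢ∈G sⱼ∈G fp fq pp′ qq′ p′q′
                      a b a′ b′ fa fb aa′ bb′ =
    let (a″ , p′a″ , aa″) = translate sᵢ∈G fp pp′ fa
        (b″ , q′b″ , bb″) = translate sⱼ∈G fq qq′ fb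
        fibre-a″ = trans (proj₂ (sᵢ∈G p p′ pp′)) (sym (proj₂ (sᵢ∈G a a″ aa″)))
        fibre-b″ = trans (proj₂ (sⱼ∈G b b″ bb″)) (sym (proj₂ (sⱼ∈G q q′ qq′)))
        ab≡a″b″ = pair-colour-transfer {p} {q} {p′} {q′} {a} {b} {a″} {b″}
                    (sym p′q′) (sym p′a″) (sym q′b″)
                    (λ z → sym (target-unique fibre-a″ (sym z)))
                    (λ z → sym (source-unique fibre-b″ (sym z)))
        a′≡a″ = target-unique (trans fa (sym (proj₂ (sᵢ∈G a a′ aa′)))) (trans aa′ (sym aa″))
        b′≡b″ = target-unique (trans fb (sym (proj₂ (sⱼ∈G b b′ bb′)))) (trans bb′ (sym bb″))
    in subst₂ (λ u v → c u v ≡ c a b) (sym a′≡a″) (sym b′≡b″) (sym ab≡a″b″)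

module BasePoints {n m : ℕ} (c : Colouring n m) (cc : IsCoherentConfiguration c)
                  (qr : IsQuasiregular c) (ab : AllGroupsAbelian c)
                  (pt : Fin m → Fin n) (bp : IsBasePointChoice c pt) where
  open Paths c cc
  open Steps c cc qr
  open Abelian c cc qr ab

  fibre-in-Gsub : ∀ {i j w v} → c w v ≡ sRel c pt i j → Gsub c pt i j (c w w)
  fibre-in-Gsub e = _ , _ , _ , sym e , (_ , _ , sym e , refl) , refl

  -- The membership unfolds to a chain
  -- of paths; path transfer moves them onto a common square and thinness
  -- identifies the two candidates for its corner q.
  fMap-square : ∀ {i j sᵢ t} → fMap c pt i j (coset c pt i j sᵢ) t →
    ∃[ p ] ∃[ q ] ∃[ p′ ] ∃[ q′ ] (c p q ≡ sRel c pt i j) × (c p p′ ≡ sᵢ) ×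
                                  (c q q′ ≡ t) × (c p′ q′ ≡ sRel c pt i j)
  fMap-square {i} {j}
    (x₁ , y₁ , z₁ , (x₂ , y₂ , z₂ , (a , b , sab , ba) ,
      (x₄ , y₄ , z₄ , (x₆ , y₆ , z₆ , s₆₆ , (a′ , b′ , sab′ , ba′) , e₆₄) , sᵢ₄₄ , e₄₂) ,
      e₂₁) , s₁₁ , t₁₁) =
    let (y₃ , t₁₃ , t₃₁) = path-transfer {x = y₂} e₂₁ refl refl
        y₃x₁ = trans (colour-transpose (trans t₁₃ (sym ba))) (sym sab)
        (y₅ , t₃₅ , t₅₁) = path-transfer {x = y₄} (trans e₄₂ (sym t₃₁)) refl refl
        (y₇ , t₃₇ , t₇₅) = path-transfer {x = y₆} (trans e₆₄ (sym t₃₅)) refl refl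
        y₃y₇ = trans t₃₇ (sym s₆₆)
        y₅y₇ = trans (colour-transpose (trans t₇₅ (sym ba′))) (sym sab′)
        (w , y₅w , wy₇) = path-transfer {x = x₁} (trans y₃y₇ (sym y₅y₇)) refl refl
        x₁≡w = source-unique (fibre-target (trans y₃x₁ (sym y₃y₇))) (sym wy₇)
        y₅x₁ = subst (λ u → c y₅ u ≡ sRel c pt i j) (sym x₁≡w) (trans y₅w y₃x₁)
    in y₅ , x₁ , y₁ , z₁ , y₅x₁ , trans t₅₁ (sym sᵢ₄₄) , t₁₁ , sym s₁₁

  module _ {i j sᵢ sⱼ} (fi : IsFiber c i) (fj : IsFiber c j)
           (sᵢ∈G : InGroup c i sᵢ) (sⱼ∈G : InGroup c j sⱼ)
           (preserves : Preserves i j sᵢ sⱼ) where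

    image⊆coset : ∀ {t} → fMap c pt i j (coset c pt i j sᵢ) t → coset c pt j i sⱼ t
    image⊆coset m′ =
      let (p , q , p′ , q′ , pq , pp′ , qq′ , p′q′) = fMap-square m′
          (y , yq′) = step-back sⱼ∈G q′ (trans (fibre-target p′q′) (bp j fj))
          py = trans (sym (preserves p y p′ q′ (trans (fibre-source pq) (bp i fi))
                                     (proj₁ (sⱼ∈G y q′ yq′)) pp′ yq′)) p′q′
      in q , y , q′ ,
         (q , p , y , colour-transpose (sym pq) , (y , p , colour-transpose (sym py) , refl) , refl) ,
         sym yq′ , qq′

    coset⊆image : ∀ {t} → coset c pt j i sⱼ t → fMap c pt i j (coset c pt i j sᵢ) t
    coset⊆image (x , y , z , (_ , y₆ , _ , s₆₆ , (_ , _ , sab , ba) , e₆₆) , syz , xz) =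
      let (b′ , xb′ , b′y₆) = path-transfer {x = y₆} e₆₆ refl refl
          b′x = colour-transpose (trans xb′ (sym s₆₆))
          b′y = colour-transpose (trans (colour-transpose (trans b′y₆ (sym ba))) (sym sab))
          fb′ = trans (fibre-source b′x) (bp i fi)
          (p′ , b′p′) = step sᵢ∈G b′ fb′
          p′z = trans (preserves b′ y p′ z fb′ (trans (fibre-target b′y) (bp j fj)) b′p′ (sym syz)) b′y
      in x , p′ , z ,
         (x , b′ , p′ , (b′ , x , sym b′x , refl) ,
           (b′ , b′ , p′ , fibre-in-Gsub b′x , sym b′p′ , refl) , refl) ,
         sym p′z , xz

  graph⇔preserves : ∀ {i j sᵢ sⱼ} → IsFiber c i → IsFiber c j →
    InGraph c pt i j sᵢ sⱼ ⇔ (InGroup c i sᵢ × InGroup c j sⱼ × Preserves i j sᵢ sⱼ)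
  graph⇔preserves {i} {j} {sᵢ} {sⱼ} fi fj = mk⇔ to from
    where
    to : InGraph c pt i j sᵢ sⱼ → InGroup c i sᵢ × InGroup c j sⱼ × Preserves i j sᵢ sⱼ
    to (sᵢ∈G , sⱼ∈G , _ , coset⊆) =
      let (z , αz) = step sⱼ∈G (pt j) (bp j fj)
          sⱼ∈coset : coset c pt j i sⱼ sⱼ
          sⱼ∈coset = pt j , pt j , z , fibre-in-Gsub {j} {i} refl , sym αz , αz
          (p , q , p′ , q′ , pq , pp′ , qq′ , p′q′) = fMap-square (coset⊆ sⱼ∈coset)
      in sᵢ∈G , sⱼ∈G ,
         preserves-from-pair sᵢ∈G sⱼ∈G (proj₁ (sᵢ∈G p p′ pp′)) (proj₁ (sⱼ∈G q q′ qq′))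
                             pp′ qq′ (trans p′q′ (sym pq))

    from : InGroup c i sᵢ × InGroup c j sⱼ × Preserves i j sᵢ sⱼ → InGraph c pt i j sᵢ sⱼ
    from (sᵢ∈G , sⱼ∈G , preserves) =
      sᵢ∈G , sⱼ∈G , image⊆coset fi fj sᵢ∈G sⱼ∈G preserves ,
                    coset⊆image fi fj sᵢ∈G sⱼ∈G preserves

  colourOf : Permutation′ n → Fin m → Fin m
  colourOf g d = c (pt d) (g ⟨$⟩ʳ pt d)

  -- Since G_d is abelian, an automorphism moves all of Ω_d as it moves α_d.
  automorphism-realises : ∀ {g} → IsAutomorphism g → Realises g (colourOf g)
  automorphism-realises {g} aut = realises λ α →
    let p = pt (fib α)
        fp = bp (fib α) (α , refl)
    in steps-commute {p} {g ⟨$⟩ʳ p} {g ⟨$⟩ʳ α} {α} (aut p p) (trans fp (aut α α)) fp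
                     refl (sym (aut p α)) refl

module FromSchurian {n m : ℕ} (c : Colouring n m) (cc : IsCoherentConfiguration c)
    (qr : IsQuasiregular c) (ab : AllGroupsAbelian c)
    (pt : Fin m → Fin n) (bp : IsBasePointChoice c pt)
    (K : Pred (Permutation′ n) 0ℓ) (K-group : IsPermGroup c K)
    (orbits : ∀ α β γ δ → (c α β ≡ c γ δ) ⇔
                          (∃[ g ] (g ∈ K) × (g ⟨$⟩ʳ α ≡ γ) × (g ⟨$⟩ʳ β ≡ δ))) where
  open Paths c cc
  open Steps c cc qr
  open BasePoints c cc qr ab pt bp

  automorphism : ∀ {g} → g ∈ K → IsAutomorphism g
  automorphism {g} g∈K α β = Equivalence.from (orbits α β _ _) (g , g∈K , refl , refl)

  H : Pred (Fin m → Fin m) 0ℓ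
  H e = ∃[ g ] (g ∈ K) × Realises g e

  H-in-G : ∀ e → e ∈ H → InG c e
  H-in-G e (g , g∈K , gₑ) = automorphism-realises-InG (automorphism g∈K) gₑ

  colourOf∈H : ∀ {g} → g ∈ K → colourOf g ∈ H
  colourOf∈H g∈K = _ , g∈K , automorphism-realises (automorphism g∈K)

  H-subgroup : IsSubgroupOfG c H
  H-subgroup = H-in-G , identity , product , inverse
    where
    identity : ∃[ e ] (e ∈ H) × (∀ d → IsFiber c d → e d ≡ d)
    identity = let (ι , ι∈K , ι-id) = proj₁ K-group in
               (λ d → d) , (ι , ι∈K , realises (λ α → cong (c α) (ι-id α))) , λ _ _ → refl

    product : ∀ e e′ → e ∈ H → e′ ∈ H → ∃[ e″ ] (e″ ∈ H) × IsProduct e e′ e″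
    product e e′ e∈H@(g , g∈K , gₑ) e′∈H@(g′ , g′∈K , g′ₑ) =
      let (τ , τ∈K , τ-composite) = proj₁ (proj₂ K-group) g g′ g∈K g′∈K
      in colourOf τ , colourOf∈H τ∈K ,
         Equivalence.from (realise-product (H-in-G e e∈H) (H-in-G e′ e′∈H) gₑ g′ₑ
                                           (automorphism-realises {τ} (automorphism τ∈K)))
                          τ-composite

    inverse : ∀ e → e ∈ H → ∃[ e′ ] (e′ ∈ H) × IsInverse e e′
    inverse e e∈H@(g , g∈K , gₑ) =
      let (τ , τ∈K , τ-inverse) = proj₂ (proj₂ K-group) g g∈K
      in colourOf τ , colourOf∈H τ∈K ,
         Equivalence.from (realise-inverse (H-in-G e e∈H) (H-in-G _ (colourOf∈H τ∈K)) gₑ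
                                           (automorphism-realises {τ} (automorphism τ∈K)))
                          τ-inverse

  H-restriction : ∀ i j → IsFiber c i → IsFiber c j → ∀ sᵢ sⱼ →
                  Restriction c H i j sᵢ sⱼ ⇔ InGraph c pt i j sᵢ sⱼ
  H-restriction i j fi fj sᵢ sⱼ = mk⇔ to from
    where
    to : Restriction c H i j sᵢ sⱼ → InGraph c pt i j sᵢ sⱼ
    to (e , e∈H@(_ , g∈K , gₑ) , eᵢ , eⱼ) =
      let e∈G = H-in-G e e∈H
      in Equivalence.from (graph⇔preserves fi fj)
           (subst (InGroup c i) eᵢ (e∈G i fi) , subst (InGroup c j) eⱼ (e∈G j fj) ,
            subst₂ (Preserves i j) eᵢ eⱼ (automorphism-preserves (automorphism g∈K) e∈G gₑ i j))

    -- K moves (α_i , α_j) to the pair of sᵢ- and sⱼ-successors, as both have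
    -- the same colour.
    from : InGraph c pt i j sᵢ sⱼ → Restriction c H i j sᵢ sⱼ
    from graph =
      let (sᵢ∈G , sⱼ∈G , preserves) = Equivalence.to (graph⇔preserves fi fj) graph
          (a′ , αa′) = step sᵢ∈G (pt i) (bp i fi)
          (b′ , αb′) = step sⱼ∈G (pt j) (bp j fj)
          same-colour = preserves (pt i) (pt j) a′ b′ (bp i fi) (bp j fj) αa′ αb′
          (g , g∈K , gαᵢ , gαⱼ) = Equivalence.to (orbits (pt i) (pt j) a′ b′) (sym same-colour)
      in colourOf g , colourOf∈H g∈K ,
         trans (cong (c (pt i)) gαᵢ) αa′ , trans (cong (c (pt j)) gαⱼ) αb′

module FromSubgroup {n m : ℕ} (c : Colouring n m) (cc : IsCoherentConfiguration c)
    (qr : IsQuasiregular c) (ab : AllGroupsAbelian c)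
    (pt : Fin m → Fin n) (bp : IsBasePointChoice c pt)
    (H : Pred (Fin m → Fin m) 0ℓ) (H-subgroup : IsSubgroupOfG c H)
    (restriction : ∀ i j → IsFiber c i → IsFiber c j → ∀ sᵢ sⱼ →
                   Restriction c H i j sᵢ sⱼ ⇔ InGraph c pt i j sᵢ sⱼ) where
  open Paths c cc
  open Steps c cc qr
  open Abelian c cc qr ab
  open BasePoints c cc qr ab pt bp

  H-in-G : ∀ e → e ∈ H → InG c e
  H-in-G = proj₁ H-subgroup

  K : Pred (Permutation′ n) 0ℓ
  K g = ∃[ e ] (e ∈ H) × Realises g e

  actionOf∈K : ∀ {e} (e∈H : e ∈ H) → actionOf e (H-in-G e e∈H) ∈ K
  actionOf∈K {e} e∈H = e , e∈H , actionOf-realises e (H-in-G e e∈H)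

  K-group : IsPermGroup c K
  K-group = identity , composition , inversion
    where
    identity : ∃[ ι ] (ι ∈ K) × (∀ x → ι ⟨$⟩ʳ x ≡ x)
    identity =
      let (ε , ε∈H , ε-id) = proj₁ (proj₂ H-subgroup)
          ε∈G = H-in-G ε ε∈H
      in actionOf ε ε∈G , actionOf∈K ε∈H ,
         realise-identity ε∈G (actionOf-realises ε ε∈G) ε-id

    composition : ∀ π σ → π ∈ K → σ ∈ K →
                  ∃[ τ ] (τ ∈ K) × (∀ x → τ ⟨$⟩ʳ x ≡ σ ⟨$⟩ʳ (π ⟨$⟩ʳ x))
    composition π σ (e , e∈H , πₑ) (e′ , e′∈H , σₑ′) =
      let (e″ , e″∈H , e″-product) = proj₁ (proj₂ (proj₂ H-subgroup)) e e′ e∈H e′∈H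
          e″∈G = H-in-G e″ e″∈H
      in actionOf e″ e″∈G , actionOf∈K e″∈H ,
         Equivalence.to (realise-product (H-in-G e e∈H) (H-in-G e′ e′∈H) πₑ σₑ′
                                         (actionOf-realises e″ e″∈G))
                        e″-product

    inversion : ∀ π → π ∈ K → ∃[ τ ] (τ ∈ K) × (∀ x → τ ⟨$⟩ʳ x ≡ π ⟨$⟩ˡ x)
    inversion π (e , e∈H , πₑ) =
      let (e′ , e′∈H , e′-inverse) = proj₂ (proj₂ (proj₂ H-subgroup)) e e∈H
          e′∈G = H-in-G e′ e′∈H
      in actionOf e′ e′∈G , actionOf∈K e′∈H ,
         Equivalence.to (realise-inverse (H-in-G e e∈H) e′∈G πₑ (actionOf-realises e′ e′∈G))
                        e′-inverse

  K-orbits : ∀ α β γ δ → (c α β ≡ c γ δ) ⇔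
                         (∃[ g ] (g ∈ K) × (g ⟨$⟩ʳ α ≡ γ) × (g ⟨$⟩ʳ β ≡ δ))
  K-orbits α β γ δ = mk⇔ to from
    where
    fα : IsFiber c (fib α)
    fα = α , refl
    fβ : IsFiber c (fib β)
    fβ = β , refl

    -- (c α γ , c β δ) preserves the pair (α , β), hence lies in the graph,
    -- hence is the restriction of some e ∈ H, whose action maps α, β to γ, δ.
    to : c α β ≡ c γ δ → ∃[ g ] (g ∈ K) × (g ⟨$⟩ʳ α ≡ γ) × (g ⟨$⟩ʳ β ≡ δ)
    to αβ≡γδ =
      let sᵢ∈G = step-in-group {α} {γ} (fibre-source αβ≡γδ)
          sⱼ∈G = step-in-group {β} {δ} (fibre-target αβ≡γδ)
          preserves = preserves-from-pair sᵢ∈G sⱼ∈G refl refl refl refl (sym αβ≡γδ)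
          graph = Equivalence.from (graph⇔preserves fα fβ) (sᵢ∈G , sⱼ∈G , preserves)
          (e , e∈H , eᵢ , eⱼ) = Equivalence.from (restriction _ _ fα fβ _ _) graph
          e∈G = H-in-G e e∈H
      in actionOf e e∈G , actionOf∈K e∈H ,
         realiser-unique e∈G (actionOf-realises e e∈G) (sym eᵢ) ,
         realiser-unique e∈G (actionOf-realises e e∈G) (sym eⱼ)

    from : (∃[ g ] (g ∈ K) × (g ⟨$⟩ʳ α ≡ γ) × (g ⟨$⟩ʳ β ≡ δ)) → c α β ≡ c γ δ
    from (g , (e , e∈H , gₑ) , gα , gβ) =
      let graph = Equivalence.to (restriction _ _ fα fβ _ _) (e , e∈H , refl , refl)
          (_ , _ , preserves) = Equivalence.to (graph⇔preserves fα fβ) graph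
      in sym (preserves α β γ δ refl refl (subst (λ u → c α u ≡ e (fib α)) gα (moves gₑ α))
                                          (subst (λ u → c β u ≡ e (fib β)) gβ (moves gₑ β)))

lemma5p1 : ∀ (n m : ℕ) (c : Colouring n m) →
    IsCoherentConfiguration c → IsQuasiregular c → AllGroupsAbelian c →
    ∀ (pt : Fin m → Fin n) → IsBasePointChoice c pt →
    (IsSchurian c ⇔
      (∃[ H ] IsSubgroupOfG c H ×
        (∀ i j → IsFiber c i → IsFiber c j → ∀ si sj →
          (Restriction c H i j si sj ⇔ InGraph c pt i j si sj))))
lemma5p1 n m c cc qr ab pt bp = mk⇔
  (λ { (K , K-group , orbits) →
         let open FromSchurian c cc qr ab pt bp K K-group orbits
         in H , H-subgroup , H-restriction })
  (λ { (H , H-subgroup , restriction) →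
         let open FromSubgroup c cc qr ab pt bp H H-subgroup restriction
         in K , K-group , K-orbits })
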